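{- Let $N\ge1$, $w\ge0$ even, $P\in V_w(N)$ and $\widetilde T_N\in R_N$. Then for every $A\in\Gamma_0(N)\backslash\Gamma_1$, $$(P|_\Theta\widetilde T_N)(A)=(P|_\Theta\widetilde T_N^{(K_A)})(A),$$ where $K_A=\Gamma_1\begin{pmatrix}N&0\\0&1\end{pmatrix}A\in\Gamma_1\backslash M_N$.
   Context: $\Gamma_1=\mathrm{SL}_2(\mathbb{Z})$. $V_w$ is the space of complex polynomials of degree $\le w$, with $P|_{ -w}\gamma(X)=P(\frac{aX+b}{cX+d})(cX+d)^w$ for $\gamma=\begin{pmatrix}a&b\\c&d\end{pmatrix}$; $V_w(N)$ is the space of maps $\Gamma_0(N)\backslash\Gamma_1\to V_w$. $M_N$ is the set of integer $2\times2$ matrices of determinant $N$, $R_N=\mathbb{Z}[M_N/\{\pm1\}]$. For $\widetilde T_N=\sum_m c_m m\in R_N$ and $K\in\Gamma_1\backslash M_N$, $\widetilde T_N^{(K)}=\sum_{m\in K}c_m m$. $\Theta_N=\{\begin{pmatrix}a&b\\c&d\end{pmatrix}\in M_N: N\mid a,N\mid c,N\mid d\}$. For $m\in M_N$: $(P|_\Theta m)(A)=P(A_m)|_{ -w}m$ if $mA^{ -1}=A_m^{ -1}m_A$ with $A_m\in\Gamma_1$ and $m_A\in\Theta_N$ (value of $P$ at the coset $\Gamma_0(N)A_m$), and $0$ otherwise; extended linearly to $R_N$. -}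

module Defs where

open import Level using (Level)
open import Data.Nat using (ℕ; zero; suc; _∸_)
open import Data.Fin using (Fin; toℕ)
open import Data.Integer using (ℤ; +_; -[1+_]) renaming (-_ to -ℤ_; _*_ to _*ℤ_; _+_ to _+ℤ_; _-_ to _-ℤ_)
open import Data.Integer.Divisibility using () renaming (_∣_ to _∣ℤ_)
open import Data.List using (List; []; _∷_; map; foldr; filter)
open import Data.Product using (Σ; _×_; _,_; proj₁; proj₂)
open import Relation.Nullary using (Dec; yes; no)
open import Relation.Binary.PropositionalEquality using (_≡_)
open import Algebra.Bundles using (CommutativeRing)

record Mat : Set where
  constructor mat
  field
    a b c d : ℤ

_·_ : Mat → Mat → Mat
mat a b c d · mat a' b' c' d' =
  mat (a *ℤ a' +ℤ b *ℤ c') (a *ℤ b' +ℤ b *ℤ d')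
      (c *ℤ a' +ℤ d *ℤ c') (c *ℤ b' +ℤ d *ℤ d')

det : Mat → ℤ
det (mat a b c d) = a *ℤ d -ℤ b *ℤ c

-- adjugate; for γ ∈ SL₂(ℤ) this is γ⁻¹
adj : Mat → Mat
adj (mat a b c d) = mat d (-ℤ b) (-ℤ c) a

record SL2 : Set where
  constructor sl
  field
    M     : Mat
    det≡1 : det M ≡ + 1

-- g ∈ Γ₀(N)  (for g ∈ Γ₁):  N ∣ c
InΓ0 : ℕ → Mat → Set
InΓ0 N g = (+ N) ∣ℤ Mat.c g

InM : ℕ → Mat → Set
InM N m = det m ≡ + N

InΘ : ℕ → Mat → Set
InΘ N m = InM N m × ((+ N) ∣ℤ Mat.a m) × ((+ N) ∣ℤ Mat.c m) × ((+ N) ∣ℤ Mat.d m)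

diagN1 : ℕ → Mat
diagN1 N = mat (+ N) (+ 0) (+ 0) (+ 1)

-- A decomposition  m A⁻¹ = A_m⁻¹ m_A  with A_m ∈ Γ₁, m_A ∈ Θ_N
record ΘDecomp (N : ℕ) (m : Mat) (A : SL2) : Set where
  field
    Am  : SL2
    mA  : Mat
    mA∈Θ : InΘ N mA
    eq  : m · adj (SL2.M A) ≡ adj (SL2.M Am) · mA

InK : ℕ → SL2 → Mat → Set
InK N A m = Σ SL2 λ γ → m ≡ (SL2.M γ · diagN1 N) · SL2.M A

-- Elements of R_N = ℤ[M_N/{±1}] are represented by finite formal sums
-- Σ c_m m, given as lists of (c_m , m) with each m ∈ M_N.
FormalSum : Set
FormalSum = List (ℤ × Mat)

restrict : (N : ℕ) (A : SL2) → ((m : Mat) → Dec (InK N A m)) → FormalSum → FormalSum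
restrict N A decK = filter (λ cm → decK (proj₂ cm))

-- Coefficients in a commutative ring R (ℂ in the paper)

module Coeff {c ℓ : Level} (R : CommutativeRing c ℓ) where
  open CommutativeRing R

  -- V_w : polynomials of degree ≤ w, as coefficient functions
  Vw : ℕ → Set c
  Vw w = Fin (suc w) → Carrier

  _≈V_ : ∀ {w} → Vw w → Vw w → Set ℓ
  P ≈V Q = ∀ k → P k ≈ Q k

  zeroV : ∀ {w} → Vw w
  zeroV _ = 0#

  fromℕ : ℕ → Carrier
  fromℕ zero = 0#
  fromℕ (suc n) = 1# + fromℕ n

  fromℤ : ℤ → Carrier
  fromℤ (+ n) = fromℕ n
  fromℤ -[1+ n ] = - fromℕ (suc n)

  -- polynomials as coefficient lists (constant term first)
  Poly : Set c
  Poly = List Carrier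

  _⊕_ : Poly → Poly → Poly
  [] ⊕ q = q
  (x ∷ p) ⊕ [] = x ∷ p
  (x ∷ p) ⊕ (y ∷ q) = (x + y) ∷ (p ⊕ q)

  _⊛_ : Poly → Poly → Poly
  [] ⊛ q = []
  (x ∷ p) ⊛ q = map (x *_) q ⊕ (0# ∷ (p ⊛ q))

  powP : Poly → ℕ → Poly
  powP p zero = 1# ∷ []
  powP p (suc n) = p ⊛ powP p n

  coeff : Poly → ℕ → Carrier
  coeff [] _ = 0#
  coeff (x ∷ p) zero = x
  coeff (x ∷ p) (suc k) = coeff p k

  sumFin : ∀ {n} → (Fin n → Poly) → Poly
  sumFin {zero} f = []
  sumFin {suc n} f = f Fin.zero ⊕ sumFin (λ i → f (Fin.suc i))
    where import Data.Fin as Fin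

  -- (P |_{-w} m)(X) = P((aX+b)/(cX+d)) (cX+d)^w
  --                 = Σ_i p_i (aX+b)^i (cX+d)^(w-i)
  slash : (w : ℕ) → Vw w → Mat → Vw w
  slash w P (mat a b c d) k =
    coeff (sumFin (λ i → map (P i *_)
                       (powP (fromℤ b ∷ fromℤ a ∷ []) (toℕ i)
                        ⊛ powP (fromℤ d ∷ fromℤ c ∷ []) (w ∸ toℕ i))))
          (toℕ k)

  -- V_w(N): maps Γ₀(N)\Γ₁ → V_w, i.e. maps on Γ₁ that are left Γ₀(N)-invariant
  InVwN : (N w : ℕ) → (SL2 → Vw w) → Set ℓ
  InVwN N w P = (g γ δ : SL2) → InΓ0 N (SL2.M g) →
                SL2.M δ ≡ SL2.M g · SL2.M γ → P δ ≈V P γ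

  slashΘ₁ : (N w : ℕ) → ((m : Mat) (A : SL2) → Dec (ΘDecomp N m A)) →
            (SL2 → Vw w) → Mat → SL2 → Vw w
  slashΘ₁ N w decΘ P m A with decΘ m A
  ... | yes dm = slash w (P (ΘDecomp.Am dm)) m
  ... | no _   = zeroV

  slashΘ : (N w : ℕ) → ((m : Mat) (A : SL2) → Dec (ΘDecomp N m A)) →
           (SL2 → Vw w) → FormalSum → SL2 → Vw w
  slashΘ N w decΘ P [] A = zeroV
  slashΘ N w decΘ P ((cm , m) ∷ T) A k =
    fromℤ cm * slashΘ₁ N w decΘ P m A k + slashΘ N w decΘ P T A k

-- A term m of T̃_N contributes to (P |_Θ T̃_N)(A) only if m admits a
-- decomposition m A⁻¹ = A_m⁻¹ m_A with A_m ∈ Γ₁ and m_A ∈ Θ_N; otherwise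
-- (P |_Θ m)(A) = 0.  Every m_A ∈ Θ_N factors as γ (N 0; 0 1) with γ ∈ Γ₁,
-- because N divides its first column and its determinant is N.  Hence
-- m = A_m⁻¹ γ (N 0; 0 1) A ∈ K_A.  So each term outside K_A contributes 0,
-- and dropping it does not change the value.
module Submission where

open import Defs
open import Level using (Level)
open import Data.Nat using (ℕ; _≤_; _*_; suc)
open import Data.List using ([]; _∷_; filter)
open import Data.List.Relation.Unary.All using (All)
open import Data.Product using (Σ; _,_; proj₂)
open import Data.Empty using (⊥-elim)
open import Relation.Nullary using (Dec; yes; no; ¬_)
open import Relation.Binary.PropositionalEquality
  using (_≡_; refl; cong; cong₂; sym; trans; module ≡-Reasoning)
open import Algebra.Bundles using (CommutativeRing)
open import Data.Integer using (ℤ; +_) renaming (_*_ to _*ℤ_; _+_ to _+ℤ_; _-_ to _-ℤ_; -_ to -ℤ_)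
open import Data.Integer.Properties using (*-cancelʳ-≡)
open import Data.Integer.Divisibility.Signed using (∣ᵤ⇒∣; divides)
open import Data.Integer.Tactic.RingSolver using (solve-∀)

mat≡ : ∀ {a b c d a' b' c' d'} → a ≡ a' → b ≡ b' → c ≡ c' → d ≡ d' →
       mat a b c d ≡ mat a' b' c' d'
mat≡ refl refl refl refl = refl

I₂ : Mat
I₂ = mat (+ 1) (+ 0) (+ 0) (+ 1)

·-assoc : ∀ X Y Z → X · (Y · Z) ≡ (X · Y) · Z
·-assoc (mat x₁ x₂ x₃ x₄) (mat y₁ y₂ y₃ y₄) (mat z₁ z₂ z₃ z₄) =
  mat≡ (entry x₁ z₁ x₂ z₃ y₁ y₂ y₃ y₄) (entry x₁ z₂ x₂ z₄ y₁ y₂ y₃ y₄)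
       (entry x₃ z₁ x₄ z₃ y₁ y₂ y₃ y₄) (entry x₃ z₂ x₄ z₄ y₁ y₂ y₃ y₄)
  where
  entry : ∀ (a b c d y₁ y₂ y₃ y₄ : ℤ) →
    a *ℤ (y₁ *ℤ b +ℤ y₂ *ℤ d) +ℤ c *ℤ (y₃ *ℤ b +ℤ y₄ *ℤ d)
      ≡ (a *ℤ y₁ +ℤ c *ℤ y₃) *ℤ b +ℤ (a *ℤ y₂ +ℤ c *ℤ y₄) *ℤ d
  entry = solve-∀

·-identityʳ : ∀ X → X · I₂ ≡ X
·-identityʳ (mat a b c d) = mat≡ (first a b) (second a b) (first c d) (second c d)
  where
  first : ∀ (x y : ℤ) → x *ℤ + 1 +ℤ y *ℤ + 0 ≡ x
  first = solve-∀
  second : ∀ (x y : ℤ) → x *ℤ + 0 +ℤ y *ℤ + 1 ≡ y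
  second = solve-∀

det-· : ∀ X Y → det (X · Y) ≡ det X *ℤ det Y
det-· (mat x₁ x₂ x₃ x₄) (mat y₁ y₂ y₃ y₄) = identity x₁ x₂ x₃ x₄ y₁ y₂ y₃ y₄
  where
  identity : ∀ (x₁ x₂ x₃ x₄ y₁ y₂ y₃ y₄ : ℤ) →
    (x₁ *ℤ y₁ +ℤ x₂ *ℤ y₃) *ℤ (x₃ *ℤ y₂ +ℤ x₄ *ℤ y₄)
      -ℤ (x₁ *ℤ y₂ +ℤ x₂ *ℤ y₄) *ℤ (x₃ *ℤ y₁ +ℤ x₄ *ℤ y₃)
      ≡ (x₁ *ℤ x₄ -ℤ x₂ *ℤ x₃) *ℤ (y₁ *ℤ y₄ -ℤ y₂ *ℤ y₃)
  identity = solve-∀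

det-adj : ∀ X → det (adj X) ≡ det X
det-adj (mat a b c d) = identity a b c d
  where
  identity : ∀ (a b c d : ℤ) → d *ℤ a -ℤ (-ℤ b) *ℤ (-ℤ c) ≡ a *ℤ d -ℤ b *ℤ c
  identity = solve-∀

adj-· : ∀ X → adj X · X ≡ mat (det X) (+ 0) (+ 0) (det X)
adj-· (mat a b c d) = mat≡ (e₁₁ a b c d) (e₁₂ b d) (e₂₁ a c) (e₂₂ a b c d)
  where
  e₁₁ : ∀ (a b c d : ℤ) → d *ℤ a +ℤ (-ℤ b) *ℤ c ≡ a *ℤ d -ℤ b *ℤ c
  e₁₁ = solve-∀
  e₁₂ : ∀ (b d : ℤ) → d *ℤ b +ℤ (-ℤ b) *ℤ d ≡ + 0
  e₁₂ = solve-∀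
  e₂₁ : ∀ (a c : ℤ) → (-ℤ c) *ℤ a +ℤ a *ℤ c ≡ + 0
  e₂₁ = solve-∀
  e₂₂ : ∀ (a b c d : ℤ) → (-ℤ c) *ℤ b +ℤ a *ℤ d ≡ a *ℤ d -ℤ b *ℤ c
  e₂₂ = solve-∀

adj-invˡ : (X : SL2) → adj (SL2.M X) · SL2.M X ≡ I₂
adj-invˡ (sl X det≡1) = trans (adj-· X) (cong (λ δ → mat δ (+ 0) (+ 0) δ) det≡1)

·adj·-cancel : (m : Mat) (X : SL2) → (m · adj (SL2.M X)) · SL2.M X ≡ m
·adj·-cancel m X = begin
  (m · adj (SL2.M X)) · SL2.M X  ≡⟨ sym (·-assoc m (adj (SL2.M X)) (SL2.M X)) ⟩
  m · (adj (SL2.M X) · SL2.M X)  ≡⟨ cong (m ·_) (adj-invˡ X) ⟩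
  m · I₂                         ≡⟨ ·-identityʳ m ⟩
  m                              ∎
  where open ≡-Reasoning

_·SL_ : SL2 → SL2 → SL2
sl X detX ·SL sl Y detY = sl (X · Y) (begin
  det (X · Y)      ≡⟨ det-· X Y ⟩
  det X *ℤ det Y   ≡⟨ cong₂ _*ℤ_ detX detY ⟩
  + 1              ∎)
  where open ≡-Reasoning

adjSL : SL2 → SL2
adjSL (sl X detX) = sl (adj X) (trans (det-adj X) detX)

-- Factorisation of Θ_N: N divides the first column of m ∈ Θ_N, so
-- m = γ (N 0; 0 1) where γ is m with its first column divided by N;
-- det γ · N = det m = N forces det γ = 1.
Θ-factor : ∀ {N} → 1 ≤ N → (m : Mat) → InΘ N m → Σ SL2 λ γ → m ≡ SL2.M γ · diagN1 N
Θ-factor {suc n} _ (mat p q r s) (detm , N∣p , N∣r , _)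
  with ∣ᵤ⇒∣ {+ suc n} {p} N∣p | ∣ᵤ⇒∣ {+ suc n} {r} N∣r
... | divides a refl | divides c refl =
  sl (mat a q c s) detγ , mat≡ (scaled a q N) (kept a q) (scaled c s N) (kept c s)
  where
  N : ℤ
  N = + suc n
  scaled : ∀ (x y n : ℤ) → x *ℤ n ≡ x *ℤ n +ℤ y *ℤ + 0
  scaled = solve-∀
  kept : ∀ (x y : ℤ) → y ≡ x *ℤ + 0 +ℤ y *ℤ + 1
  kept = solve-∀
  detScaled : ∀ (a q c s n : ℤ) → (a *ℤ n) *ℤ s -ℤ q *ℤ (c *ℤ n) ≡ (a *ℤ s -ℤ q *ℤ c) *ℤ n
  detScaled = solve-∀
  unitˡ : ∀ (n : ℤ) → n ≡ + 1 *ℤ n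
  unitˡ = solve-∀
  detγ : a *ℤ s -ℤ q *ℤ c ≡ + 1
  detγ = *-cancelʳ-≡ _ _ N (begin
    (a *ℤ s -ℤ q *ℤ c) *ℤ N          ≡⟨ sym (detScaled a q c s N) ⟩
    (a *ℤ N) *ℤ s -ℤ q *ℤ (c *ℤ N)   ≡⟨ detm ⟩
    N                                ≡⟨ unitˡ N ⟩
    + 1 *ℤ N                         ∎)
    where open ≡-Reasoning

-- A Θ-decomposition m A⁻¹ = A_m⁻¹ m_A places m in K_A: writing
-- m_A = γ (N 0; 0 1) gives m = (A_m⁻¹ γ) (N 0; 0 1) A.
ΘDecomp⇒InK : ∀ {N} → 1 ≤ N → (m : Mat) (A : SL2) → ΘDecomp N m A → InK N A m
ΘDecomp⇒InK {N} N≥1 m A record { Am = Am ; mA = mA ; mA∈Θ = mA∈Θ ; eq = eq }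
  with Θ-factor N≥1 mA mA∈Θ
... | γ , refl = adjSL Am ·SL γ , (begin
  m                                          ≡⟨ sym (·adj·-cancel m A) ⟩
  (m · adj (SL2.M A)) · SL2.M A              ≡⟨ cong (_· SL2.M A) eq ⟩
  (adj (SL2.M Am) · (SL2.M γ · D)) · SL2.M A ≡⟨ cong (_· SL2.M A) (·-assoc (adj (SL2.M Am)) (SL2.M γ) D) ⟩
  ((adj (SL2.M Am) · SL2.M γ) · D) · SL2.M A ∎)
  where
  D : Mat
  D = diagN1 N
  open ≡-Reasoning

module ΘSlash {c ℓ : Level} (R : CommutativeRing c ℓ) (N w : ℕ)
  (decΘ : (m : Mat) (A : SL2) → Dec (ΘDecomp N m A)) (P : SL2 → Coeff.Vw R w) where

  open CommutativeRing R using (_+_; +-congʳ; +-congˡ; *-congˡ; zeroʳ; +-identityˡ; setoid) renaming (refl to ≈-refl; _*_ to _*ᴿ_)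
  open Coeff R using (_≈V_; zeroV; fromℤ; slashΘ₁; slashΘ)
  open import Relation.Binary.Reasoning.Setoid setoid

  slashΘ₁-vanishes : (m : Mat) (A : SL2) → ¬ ΘDecomp N m A → slashΘ₁ N w decΘ P m A ≈V zeroV
  slashΘ₁-vanishes m A noDecomp k with decΘ m A
  ... | yes decomp = ⊥-elim (noDecomp decomp)
  ... | no _       = ≈-refl

  slashΘ-filter : {Q : Mat → Set} (Q? : (m : Mat) → Dec (Q m)) (A : SL2) →
    ((m : Mat) → ΘDecomp N m A → Q m) → (T : FormalSum) →
    slashΘ N w decΘ P T A ≈V slashΘ N w decΘ P (filter (λ cm → Q? (proj₂ cm)) T) A
  slashΘ-filter Q? A decomp⇒Q [] k = ≈-refl
  slashΘ-filter Q? A decomp⇒Q ((cm , m) ∷ T) k with Q? m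
  ... | yes _ = +-congˡ (slashΘ-filter Q? A decomp⇒Q T k)
  ... | no ¬Q = begin
    fromℤ cm *ᴿ slashΘ₁ N w decΘ P m A k + slashΘ N w decΘ P T A k
      ≈⟨ +-congʳ (*-congˡ (slashΘ₁-vanishes m A (λ d → ¬Q (decomp⇒Q m d)) k)) ⟩
    fromℤ cm *ᴿ zeroV k + slashΘ N w decΘ P T A k
      ≈⟨ +-congʳ (zeroʳ (fromℤ cm)) ⟩
    zeroV k + slashΘ N w decΘ P T A k
      ≈⟨ +-identityˡ _ ⟩
    slashΘ N w decΘ P T A k
      ≈⟨ slashΘ-filter Q? A decomp⇒Q T k ⟩
    slashΘ N w decΘ P (filter (λ cm → Q? (proj₂ cm)) T) A k
      ∎

-- Lemma 2.3: restricting T̃_N to K_A is the filter by membership in K_A,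
-- and every Θ-decomposable term lies in K_A.
lemma2p3 : {c ℓ : Level} (R : CommutativeRing c ℓ) (N w : ℕ) → 1 ≤ N → Σ ℕ (λ k → w ≡ 2 * k) →
    (decΘ : (m : Mat) (A : SL2) → Dec (ΘDecomp N m A)) →
    (P : SL2 → Coeff.Vw R w) → Coeff.InVwN R N w P →
    (T : FormalSum) → All (λ cm → InM N (proj₂ cm)) T →
    (A : SL2) → (decK : (m : Mat) → Dec (InK N A m)) →
    Coeff._≈V_ R (Coeff.slashΘ R N w decΘ P T A) (Coeff.slashΘ R N w decΘ P (restrict N A decK T) A)
lemma2p3 R N w N≥1 _ decΘ P _ T _ A decK =
  ΘSlash.slashΘ-filter R N w decΘ P decK A (λ m → ΘDecomp⇒InK N≥1 m A) T
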